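{- Let $m\geq 2$ be an integer, and let $\delta(m)=\lceil\log_2(m/3)\rceil$. (i) If $y$ and $v$ are finite words (with $v$ possibly empty) such that $yvy$ is a factor of ${\bf t}$ and $|y|=m$, then $2^{\delta(m)}$ divides $|yv|$. (ii) There is a factor of ${\bf t}$ of the form $yvy$ (with $v$ possibly empty) such that $|y|=m$ and $2^{\delta(m)+1}$ does not divide $|yv|$.
   Context: The Thue-Morse word is the infinite binary word ${\bf t}={\bf t}_1{\bf t}_2{\bf t}_3\cdots$, where ${\bf t}_i\in\{0,1\}$ has the same parity as the number of $1$'s in the binary expansion of $i-1$. A factor of ${\bf t}$ is a finite contiguous subword ${\bf t}_\alpha{\bf t}_{\alpha+1}\cdots{\bf t}_\beta$. For a word $w$, $|w|$ denotes its length. -}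

module Defs where

open import Data.Bool using (Bool; true; false; _xor_)
open import Data.Nat using (ℕ; zero; suc; _+_; _*_; _/_; _%_; _≡ᵇ_)
open import Data.Nat.Logarithm using (⌈log₂_⌉)
open import Data.List using (List; map; upTo; length; _++_)
open import Data.Product using (Σ; _×_; ∃-syntax)
open import Relation.Binary.PropositionalEquality using (_≡_)

-- Parity of the number of 1's in the binary expansion of n, computed with
-- fuel (fuel ≥ number of binary digits suffices; we use fuel = n).
parityBits : ℕ → ℕ → Bool
parityBits zero    n = false
parityBits (suc f) n = (n % 2 ≡ᵇ 1) xor parityBits f (n / 2)

-- 0-indexed Thue–Morse sequence: tm n = parity of popcount of n.
-- The paper's t_i (1-indexed) equals tm (i - 1).
tm : ℕ → Bool
tm n = parityBits n n

slice : ℕ → ℕ → List Bool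
slice i len = map (λ k → tm (i + k)) (upTo len)

IsFactor : List Bool → Set
IsFactor w = ∃[ i ] (w ≡ slice i (length w))

-- δ(m) = ⌈log₂(m/3)⌉.  For m ≥ 2 this equals ⌈log₂ ⌈m/3⌉⌉ (the least
-- d ∈ ℕ with m ≤ 3·2^d), and ⌈m/3⌉ = (m + 2) / 3.
δ : ℕ → ℕ
δ m = ⌈log₂ ((m + 2) / 3) ⌉

-- Let t be the Thue–Morse word indexed from 0, so that t(b + 2n) = t(b) xor t(n) for b < 2.
-- (i) If t agrees with itself on windows of length m > 3·2^e at i and i + n, then n is even:
-- an odd shift would force three equal consecutive letters, while t(2k+1) = not t(2k).
-- Since t(b + 2k) determines t(k), halving all positions keeps the agreement on a window of
-- about half the length, and induction on e gives 2^(e+1) ∣ n.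
-- (ii) Iterating gives t(r + c·2^d) = t(r) xor t(c) for r < 2^d. As t agrees on the windows
-- [2,5) and [11,14), scaling by 2^d yields a repetition of length 3·2^d at distance 9·2^d.
module Submission where

open import Defs
open import Data.Bool using (Bool; true; false; not; _xor_)
open import Data.Bool.Properties using (not-involutive; not-injective; not-¬; xor-assoc)
open import Data.Empty using (⊥-elim)
open import Data.List using (List; []; _∷_; _++_; length; map; upTo; applyUpTo)
open import Data.List.Properties using (∷-injective; length-++; length-map; length-upTo; map-applyUpTo; map-cong; map-cong-local)
open import Data.List.Relation.Unary.All using (All; []; _∷_)
open import Data.List.Relation.Unary.All.Properties using (applyUpTo⁺₁; applyUpTo⁻)
open import Data.Nat
open import Data.Nat.DivMod
open import Data.Nat.Divisibility using (_∣_; divides; 1∣_; n∣m⇒m%n≡0; *-monoˡ-∣; *-cancelˡ-∣)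
open import Data.Nat.Logarithm using (⌈log₂_⌉; ⌈log₂⌉-mono-≤; ⌈log₂⌈n/2⌉⌉≡⌈log₂n⌉∸1; ⌈log₂2^n⌉≡n)
open import Data.Nat.Properties
open import Data.Nat.Tactic.RingSolver using (solve-∀)
open import Data.Product using (_×_; _,_; proj₁; proj₂; ∃-syntax)
open import Function using (id; _∘_)
open import Relation.Binary.PropositionalEquality
open import Relation.Nullary using (¬_; yes; no)

module _ {A : Set} where

  applyUpTo-++ : ∀ (f : ℕ → A) a b → applyUpTo f (a + b) ≡ applyUpTo f a ++ applyUpTo (λ k → f (a + k)) b
  applyUpTo-++ f zero    b = refl
  applyUpTo-++ f (suc a) b = cong (f 0 ∷_) (applyUpTo-++ (λ k → f (suc k)) a b)

  ++-injective : ∀ (xs ys : List A) {xs′ ys′} → length xs ≡ length ys → xs ++ xs′ ≡ ys ++ ys′ → xs ≡ ys × xs′ ≡ ys′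
  ++-injective []       []       _   eq = refl , eq
  ++-injective (x ∷ xs) (y ∷ ys) len eq with ∷-injective eq
  ... | x≡y , rest with ++-injective xs ys (suc-injective len) rest
  ... | xs≡ys , xs′≡ys′ = cong₂ _∷_ x≡y xs≡ys , xs′≡ys′

map-cong-local⁻ : ∀ {A B : Set} {f g : A → B} xs → map f xs ≡ map g xs → All (λ x → f x ≡ g x) xs
map-cong-local⁻ []       _  = []
map-cong-local⁻ (x ∷ xs) eq = proj₁ (∷-injective eq) ∷ map-cong-local⁻ xs (proj₂ (∷-injective eq))

parityBits-zero : ∀ f → parityBits f 0 ≡ false
parityBits-zero zero    = refl
parityBits-zero (suc f) = parityBits-zero f

n≤1+f⇒n/2≤f : ∀ {n f} → n ≤ suc f → n / 2 ≤ f
n≤1+f⇒n/2≤f {zero}  _ = z≤n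
n≤1+f⇒n/2≤f {suc n} n≤1+f = ≤-pred (≤-trans (m/n<m (suc n) 2 (s≤s (s≤s z≤n))) n≤1+f)

parityBits-fuel : ∀ {f g} n → n ≤ f → n ≤ g → parityBits f n ≡ parityBits g n
parityBits-fuel {zero}  {zero}  n _ _ = refl
parityBits-fuel {zero}  {suc g} n z≤n _ = sym (parityBits-zero g)
parityBits-fuel {suc f} {zero}  n _ z≤n = parityBits-zero f
parityBits-fuel {suc f} {suc g} n n≤f n≤g =
  cong ((n % 2 ≡ᵇ 1) xor_) (parityBits-fuel (n / 2) (n≤1+f⇒n/2≤f n≤f) (n≤1+f⇒n/2≤f n≤g))

tm-unfold : ∀ n → tm n ≡ (n % 2 ≡ᵇ 1) xor tm (n / 2)
tm-unfold zero    = refl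
tm-unfold (suc n) = cong ((suc n % 2 ≡ᵇ 1) xor_) (parityBits-fuel {n} (suc n / 2) (n≤1+f⇒n/2≤f ≤-refl) ≤-refl)

tm-bit : ∀ {b} n → b < 2 → tm (b + n * 2) ≡ tm b xor tm n
tm-bit {b} n b<2 = begin
  tm (b + n * 2)                                   ≡⟨ tm-unfold (b + n * 2) ⟩
  ((b + n * 2) % 2 ≡ᵇ 1) xor tm ((b + n * 2) / 2)  ≡⟨ cong₂ (λ r q → (r ≡ᵇ 1) xor tm q) ([m+kn]%n≡m%n b n 2) quotient ⟩
  (b % 2 ≡ᵇ 1) xor tm (b / 2 + n)                  ≡⟨ low-bit b<2 ⟩
  tm b xor tm n                                    ∎
  where
  open ≡-Reasoning
  quotient : (b + n * 2) / 2 ≡ b / 2 + n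
  quotient = trans (+-distrib-/-∣ʳ b (divides n refl)) (cong (b / 2 +_) (m*n/n≡m n 2))
  low-bit : ∀ {b} → b < 2 → (b % 2 ≡ᵇ 1) xor tm (b / 2 + n) ≡ tm b xor tm n
  low-bit z<s       = refl
  low-bit (s<s z<s) = refl

tm-even : ∀ n → tm (n * 2) ≡ tm n
tm-even n = tm-bit n z<s

tm-odd : ∀ n → tm (1 + n * 2) ≡ not (tm n)
tm-odd n = tm-bit n (s<s z<s)

tm-digits : ∀ d {r} a → r < 2 ^ d → tm (r + a * 2 ^ d) ≡ tm r xor tm a
tm-digits zero    {zero} a _ = cong tm (*-identityʳ a)
tm-digits zero    {suc r} a (s<s ())
tm-digits (suc d) {r}    a r<2^[1+d] = begin
  tm (r + a * 2 ^ suc d)                  ≡⟨ cong tm regroup ⟩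
  tm (r % 2 + (r / 2 + a * 2 ^ d) * 2)    ≡⟨ tm-bit (r / 2 + a * 2 ^ d) (m%n<n r 2) ⟩
  tm (r % 2) xor tm (r / 2 + a * 2 ^ d)   ≡⟨ cong (tm (r % 2) xor_) (tm-digits d a r/2<2^d) ⟩
  tm (r % 2) xor (tm (r / 2) xor tm a)    ≡⟨ xor-assoc (tm (r % 2)) _ _ ⟨
  (tm (r % 2) xor tm (r / 2)) xor tm a    ≡⟨ cong (_xor tm a) (tm-bit (r / 2) (m%n<n r 2)) ⟨
  tm (r % 2 + r / 2 * 2) xor tm a         ≡⟨ cong (λ s → tm s xor tm a) (m≡m%n+[m/n]*n r 2) ⟨
  tm r xor tm a                           ∎
  where
  open ≡-Reasoning
  regroup : r + a * 2 ^ suc d ≡ r % 2 + (r / 2 + a * 2 ^ d) * 2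
  regroup = begin
    r + a * (2 * 2 ^ d)                     ≡⟨ cong (_+ a * (2 * 2 ^ d)) (m≡m%n+[m/n]*n r 2) ⟩
    r % 2 + r / 2 * 2 + a * (2 * 2 ^ d)     ≡⟨ semiring-law (r % 2) (r / 2) a (2 ^ d) ⟩
    r % 2 + (r / 2 + a * 2 ^ d) * 2         ∎
    where
    semiring-law : ∀ b q a p → b + q * 2 + a * (2 * p) ≡ b + (q + a * p) * 2
    semiring-law = solve-∀
  r/2<2^d : r / 2 < 2 ^ d
  r/2<2^d = m<n*o⇒m/o<n (subst (r <_) (*-comm 2 (2 ^ d)) r<2^[1+d])

data EvenOrOdd : ℕ → Set where
  even : ∀ k → EvenOrOdd (k * 2)
  odd  : ∀ k → EvenOrOdd (1 + k * 2)

evenOrOdd : ∀ n → EvenOrOdd n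
evenOrOdd zero = even 0
evenOrOdd (suc n) with evenOrOdd n
... | even k = odd k
... | odd k  = even (suc k)

tm-even≢odd : ∀ k → tm (k * 2) ≢ tm (1 + k * 2)
tm-even≢odd k eq = not-¬ (tm-even k) (trans eq (tm-odd k))

tm-no-triple : ∀ n → ¬ (tm n ≡ tm (1 + n) × tm (1 + n) ≡ tm (2 + n))
tm-no-triple n with evenOrOdd n
... | even k = λ (eq , _) → tm-even≢odd k eq
... | odd k  = λ (_ , eq) → tm-even≢odd (suc k) eq

record Agree (m i j : ℕ) : Set where
  constructor agree
  field at : ∀ {k} → k < m → tm (i + k) ≡ tm (j + k)
open Agree

Agree-≤ : ∀ {m m′ i j} → m′ ≤ m → Agree m i j → Agree m′ i j
Agree-≤ m′≤m h = agree λ k<m′ → at h (<-≤-trans k<m′ m′≤m)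

Agree-sym : ∀ {m i j} → Agree m i j → Agree m j i
Agree-sym h = agree λ k<m → sym (at h k<m)

¬Agree-even-odd : ∀ a b → ¬ Agree 4 (a * 2) (1 + b * 2)
¬Agree-even-odd a b h = tm-no-triple b
  ( twin a b (at′ z<s) (at′ (s<s z<s))
  , twin (suc a) (suc b) (at′ (s<s (s<s z<s))) (at′ (s<s (s<s (s<s z<s)))))
  where
  open ≡-Reasoning
  at′ : ∀ {k} → k < 4 → tm (k + a * 2) ≡ tm (k + (1 + b * 2))
  at′ {k} k<4 = subst₂ (λ p q → tm p ≡ tm q) (+-comm (a * 2) k) (+-comm (1 + b * 2) k) (at h k<4)
  twin : ∀ a b → tm (a * 2) ≡ tm (1 + b * 2) → tm (1 + a * 2) ≡ tm (suc b * 2) → tm b ≡ tm (suc b)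
  twin a b eq₀ eq₁ = begin
    tm b                    ≡⟨ not-involutive (tm b) ⟨
    not (not (tm b))        ≡⟨ cong not (tm-odd b) ⟨
    not (tm (1 + b * 2))    ≡⟨ cong not eq₀ ⟨
    not (tm (a * 2))        ≡⟨ cong not (tm-even a) ⟩
    not (tm a)              ≡⟨ tm-odd a ⟨
    tm (1 + a * 2)          ≡⟨ eq₁ ⟩
    tm (suc b * 2)          ≡⟨ tm-even (suc b) ⟩
    tm (suc b)              ∎

Agree-shift-even : ∀ {i n} → Agree 4 i (i + n) → 2 ∣ n
Agree-shift-even {i} {n} h with evenOrOdd n | evenOrOdd i
... | even k | _      = divides k refl
... | odd k  | even a = ⊥-elim (¬Agree-even-odd a (a + k) (subst (Agree 4 (a * 2)) (shift-law a k) h))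
  where
  shift-law : ∀ a k → a * 2 + (1 + k * 2) ≡ 1 + (a + k) * 2
  shift-law = solve-∀
... | odd k  | odd a  =
  ⊥-elim (¬Agree-even-odd (suc (a + k)) a (Agree-sym (subst (Agree 4 (1 + a * 2)) (shift-law a k) h)))
  where
  shift-law : ∀ a k → 1 + a * 2 + (1 + k * 2) ≡ suc (a + k) * 2
  shift-law = solve-∀

Agree-halve : ∀ {m i n} → Agree (suc (m * 2)) i (i + n * 2) → Agree (suc m) (i / 2) (i / 2 + n)
Agree-halve {i = i} {n = n} h = agree λ {k} k≤m → xor-cancelˡ (tm b) (begin
  tm b xor tm (a + k)              ≡⟨ tm-bit (a + k) b<2 ⟨
  tm (b + (a + k) * 2)             ≡⟨ cong tm (index-law b a k) ⟨
  tm (b + a * 2 + k * 2)           ≡⟨ cong (λ j → tm (j + k * 2)) i≡ ⟨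
  tm (i + k * 2)                   ≡⟨ at h (s≤s (*-monoˡ-≤ 2 (≤-pred k≤m))) ⟩
  tm (i + n * 2 + k * 2)           ≡⟨ cong (λ j → tm (j + n * 2 + k * 2)) i≡ ⟩
  tm (b + a * 2 + n * 2 + k * 2)   ≡⟨ cong (λ j → tm (j + k * 2)) (index-law b a n) ⟩
  tm (b + (a + n) * 2 + k * 2)     ≡⟨ cong tm (index-law b (a + n) k) ⟩
  tm (b + (a + n + k) * 2)         ≡⟨ tm-bit (a + n + k) b<2 ⟩
  tm b xor tm (a + n + k)          ∎)
  where
  open ≡-Reasoning
  a = i / 2
  b = i % 2
  b<2 = m%n<n i 2
  i≡ : i ≡ b + a * 2
  i≡ = m≡m%n+[m/n]*n i 2
  index-law : ∀ b a k → b + a * 2 + k * 2 ≡ b + (a + k) * 2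
  index-law = solve-∀
  xor-cancelˡ : ∀ x {y z} → x xor y ≡ x xor z → y ≡ z
  xor-cancelˡ false eq = eq
  xor-cancelˡ true  eq = not-injective eq

Agree⇒2^[1+e]∣shift : ∀ e {i n} → Agree (suc (2 ^ e * 3)) i (i + n) → 2 ^ suc e ∣ n
Agree⇒2^[1+e]∣shift zero    h = Agree-shift-even h
Agree⇒2^[1+e]∣shift (suc e) {i} h with Agree-shift-even (Agree-≤ 4≤window h)
  where
  4≤window : 4 ≤ suc (2 ^ suc e * 3)
  4≤window = s≤s (*-monoˡ-≤ 3 (m^n>0 2 (suc e)))
... | divides n′ refl =
  subst (_∣ n′ * 2) (*-comm (2 ^ suc e) 2) (*-monoˡ-∣ 2 (Agree⇒2^[1+e]∣shift e (Agree-halve {n = n′} halvable)))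
  where
  size-law : ∀ x → 2 * x * 3 ≡ x * 3 * 2
  size-law = solve-∀
  halvable : Agree (suc (2 ^ e * 3 * 2)) i (i + n′ * 2)
  halvable = subst (λ l → Agree (suc l) i (i + n′ * 2)) (size-law (2 ^ e)) h

n≤2^⌈log₂n⌉ : ∀ n → n ≤ 2 ^ ⌈log₂ n ⌉
n≤2^⌈log₂n⌉ n = bounded ⌈log₂ n ⌉ n refl
  where
  open ≤-Reasoning
  bounded : ∀ k n → ⌈log₂ n ⌉ ≡ k → n ≤ 2 ^ k
  bounded zero    zero          _      = z≤n
  bounded zero    (suc zero)    _      = s≤s z≤n
  bounded zero    (suc (suc n)) log≡0 with subst (⌈log₂ 2 ⌉ ≤_) log≡0 (⌈log₂⌉-mono-≤ (s≤s (s≤s (z≤n {n}))))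
  ... | ()
  bounded (suc k) n log≡1+k = begin
    n                           ≡⟨ ⌊n/2⌋+⌈n/2⌉≡n n ⟨
    ⌊ n /2⌋ + ⌈ n /2⌉           ≤⟨ +-monoˡ-≤ ⌈ n /2⌉ (⌊n/2⌋≤⌈n/2⌉ n) ⟩
    ⌈ n /2⌉ + ⌈ n /2⌉           ≤⟨ +-mono-≤ half≤2^k half≤2^k ⟩
    2 ^ k + 2 ^ k               ≡⟨ cong (2 ^ k +_) (+-identityʳ (2 ^ k)) ⟨
    2 ^ suc k                   ∎
    where
    half≤2^k : ⌈ n /2⌉ ≤ 2 ^ k
    half≤2^k = bounded k ⌈ n /2⌉ (trans (⌈log₂⌈n/2⌉⌉≡⌈log₂n⌉∸1 n) (cong (_∸ 1) log≡1+k))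

⌈log₂n⌉≡1+e⇒2^e<n : ∀ {n e} → ⌈log₂ n ⌉ ≡ suc e → 2 ^ e < n
⌈log₂n⌉≡1+e⇒2^e<n {n} {e} log≡1+e with n ≤? 2 ^ e
... | no  n≰2^e = ≰⇒> n≰2^e
... | yes n≤2^e = ⊥-elim (<-irrefl refl (begin-strict
  e                  <⟨ n<1+n e ⟩
  suc e              ≡⟨ log≡1+e ⟨
  ⌈log₂ n ⌉          ≤⟨ ⌈log₂⌉-mono-≤ n≤2^e ⟩
  ⌈log₂ 2 ^ e ⌉      ≡⟨ ⌈log₂2^n⌉≡n e ⟩
  e                  ∎))
  where open ≤-Reasoning

m≤2^δ[m]*3 : ∀ m → m ≤ 2 ^ δ m * 3
m≤2^δ[m]*3 m = begin
  m                   ≤⟨ +-cancelˡ-≤ 2 m _ m+2≤ ⟩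
  (m + 2) / 3 * 3     ≤⟨ *-monoˡ-≤ 3 (n≤2^⌈log₂n⌉ ((m + 2) / 3)) ⟩
  2 ^ δ m * 3         ∎
  where
  open ≤-Reasoning
  m+2≤ : 2 + m ≤ 2 + (m + 2) / 3 * 3
  m+2≤ = begin
    2 + m                               ≡⟨ +-comm 2 m ⟩
    m + 2                               ≡⟨ m≡m%n+[m/n]*n (m + 2) 3 ⟩
    (m + 2) % 3 + (m + 2) / 3 * 3       ≤⟨ +-monoˡ-≤ _ (≤-pred (m%n<n (m + 2) 3)) ⟩
    2 + (m + 2) / 3 * 3                 ∎

δ[m]≡1+e⇒2^e*3<m : ∀ m {e} → δ m ≡ suc e → 2 ^ e * 3 < m
δ[m]≡1+e⇒2^e*3<m m {e} δ≡1+e = ≤-pred (≤-pred (begin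
  suc (2 ^ e) * 3     ≤⟨ *-monoˡ-≤ 3 (⌈log₂n⌉≡1+e⇒2^e<n {(m + 2) / 3} δ≡1+e) ⟩
  (m + 2) / 3 * 3     ≤⟨ m/n*n≤m (m + 2) 3 ⟩
  m + 2               ≡⟨ +-comm m 2 ⟩
  2 + m               ∎))
  where open ≤-Reasoning

Agree⇒2^δ∣shift : ∀ m {i n} → Agree m i (i + n) → 2 ^ δ m ∣ n
Agree⇒2^δ∣shift m {n = n} h with δ m in δ≡
... | zero  = 1∣ n
... | suc e = Agree⇒2^[1+e]∣shift e (Agree-≤ (δ[m]≡1+e⇒2^e*3<m m δ≡) h)

length-slice : ∀ i n → length (slice i n) ≡ n
length-slice i n = trans (length-map _ (upTo n)) (length-upTo n)

slice-++ : ∀ i a b → slice i (a + b) ≡ slice i a ++ slice (i + a) b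
slice-++ i a b = begin
  slice i (a + b)                                      ≡⟨ map-applyUpTo id f (a + b) ⟩
  applyUpTo f (a + b)                                  ≡⟨ applyUpTo-++ f a b ⟩
  applyUpTo f a ++ applyUpTo (λ k → f (a + k)) b       ≡⟨ cong₂ _++_ (map-applyUpTo id f a) (map-applyUpTo id _ b) ⟨
  slice i a ++ map (λ k → tm (i + (a + k))) (upTo b)   ≡⟨ cong (slice i a ++_) (map-cong (λ k → cong tm (+-assoc i a k)) (upTo b)) ⟨
  slice i a ++ slice (i + a) b                         ∎
  where
  open ≡-Reasoning
  f : ℕ → Bool
  f k = tm (i + k)

Agree⇒slice≡ : ∀ {m i j} → Agree m i j → slice i m ≡ slice j m
Agree⇒slice≡ {m} h = map-cong-local (applyUpTo⁺₁ id m (at h))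

slice≡⇒Agree : ∀ {m i j} → slice i m ≡ slice j m → Agree m i j
slice≡⇒Agree {m} eq = agree (applyUpTo⁻ id m (map-cong-local⁻ (upTo m) eq))

slice⇒IsFactor : ∀ {w} i n → w ≡ slice i n → IsFactor w
slice⇒IsFactor i n refl = i , cong (slice i) (sym (length-slice i n))

IsFactor-repetition⇒Agree : ∀ {m} y v → length y ≡ m → IsFactor (y ++ v ++ y) → ∃[ i ] Agree m i (i + length (y ++ v))
IsFactor-repetition⇒Agree y v refl (i , eq) = i , subst (Agree ∣y∣ i) shift (slice≡⇒Agree (trans (sym y≡first) y≡last))
  where
  open ≡-Reasoning
  ∣y∣ = length y
  ∣v∣ = length v
  shift : i + ∣y∣ + ∣v∣ ≡ i + length (y ++ v)
  shift = trans (+-assoc i ∣y∣ ∣v∣) (cong (i +_) (sym (length-++ y)))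
  split : y ++ v ++ y ≡ slice i ∣y∣ ++ slice (i + ∣y∣) ∣v∣ ++ slice (i + ∣y∣ + ∣v∣) ∣y∣
  split = begin
    y ++ v ++ y                                                  ≡⟨ eq ⟩
    slice i (length (y ++ v ++ y))                               ≡⟨ cong (slice i) (trans (length-++ y) (cong (∣y∣ +_) (length-++ v))) ⟩
    slice i (∣y∣ + (∣v∣ + ∣y∣))                                   ≡⟨ slice-++ i ∣y∣ (∣v∣ + ∣y∣) ⟩
    slice i ∣y∣ ++ slice (i + ∣y∣) (∣v∣ + ∣y∣)                     ≡⟨ cong (slice i ∣y∣ ++_) (slice-++ (i + ∣y∣) ∣v∣ ∣y∣) ⟩
    slice i ∣y∣ ++ slice (i + ∣y∣) ∣v∣ ++ slice (i + ∣y∣ + ∣v∣) ∣y∣  ∎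
  first-and-rest : y ≡ slice i ∣y∣ × v ++ y ≡ slice (i + ∣y∣) ∣v∣ ++ slice (i + ∣y∣ + ∣v∣) ∣y∣
  first-and-rest = ++-injective y (slice i ∣y∣) (sym (length-slice i ∣y∣)) split
  y≡first : y ≡ slice i ∣y∣
  y≡first = proj₁ first-and-rest
  y≡last : y ≡ slice (i + ∣y∣ + ∣v∣) ∣y∣
  y≡last = proj₂ (++-injective v (slice (i + ∣y∣) ∣v∣) (sym (length-slice (i + ∣y∣) ∣v∣)) (proj₂ first-and-rest))

tm-window-period : ∀ d → Agree (2 ^ d * 3) (2 ^ d * 2) (2 ^ d * 11)
tm-window-period d = agree window
  where
  x = 2 ^ d
  instance
    x≢0 : NonZero x
    x≢0 = m^n≢0 2 d
  tm[2+c]≡tm[11+c] : ∀ {c} → c < 3 → tm (2 + c) ≡ tm (11 + c)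
  tm[2+c]≡tm[11+c] z<s             = refl
  tm[2+c]≡tm[11+c] (s<s z<s)       = refl
  tm[2+c]≡tm[11+c] (s<s (s<s z<s)) = refl
  window : ∀ {k} → k < x * 3 → tm (x * 2 + k) ≡ tm (x * 11 + k)
  window {k} k<3x = begin
    tm (x * 2 + k)           ≡⟨ cong tm (digits 2) ⟩
    tm (r + (2 + c) * x)     ≡⟨ tm-digits d (2 + c) r<x ⟩
    tm r xor tm (2 + c)      ≡⟨ cong (tm r xor_) (tm[2+c]≡tm[11+c] c<3) ⟩
    tm r xor tm (11 + c)     ≡⟨ tm-digits d (11 + c) r<x ⟨
    tm (r + (11 + c) * x)    ≡⟨ cong tm (digits 11) ⟨
    tm (x * 11 + k)          ∎
    where
    open ≡-Reasoning
    r = k % x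
    c = k / x
    r<x : r < x
    r<x = m%n<n k x
    c<3 : c < 3
    c<3 = m<n*o⇒m/o<n (subst (k <_) (*-comm x 3) k<3x)
    regroup : ∀ x a r c → x * a + (r + c * x) ≡ r + (a + c) * x
    regroup = solve-∀
    digits : ∀ a → x * a + k ≡ r + (a + c) * x
    digits a = trans (cong (x * a +_) (m≡m%n+[m/n]*n k x)) (regroup x a r c)

tm-repetition : ∀ d {m} → m ≤ 2 ^ d * 3 →
  ∃[ y ] ∃[ v ] (length y ≡ m × IsFactor (y ++ v ++ y) × length (y ++ v) ≡ 2 ^ d * 9)
tm-repetition d {m} m≤3x = y , v , length-slice p m , slice⇒IsFactor p _ yvy≡slice , ∣yv∣≡gap
  where
  open ≡-Reasoning
  p = 2 ^ d * 2
  gap = 2 ^ d * 9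
  m≤gap : m ≤ gap
  m≤gap = ≤-trans m≤3x (*-monoʳ-≤ (2 ^ d) (s≤s (s≤s (s≤s z≤n))))
  y = slice p m
  v = slice (p + m) (gap ∸ m)
  second-start : p + m + (gap ∸ m) ≡ 2 ^ d * 11
  second-start = trans (+-assoc p m _) (trans (cong (p +_) (m+[n∸m]≡n m≤gap)) (sym (*-distribˡ-+ (2 ^ d) 2 9)))
  yvy≡slice : y ++ v ++ y ≡ slice p (m + ((gap ∸ m) + m))
  yvy≡slice = begin
    y ++ v ++ y                               ≡⟨ cong (λ w → y ++ v ++ w) (Agree⇒slice≡ (Agree-≤ m≤3x (tm-window-period d))) ⟩
    y ++ v ++ slice (2 ^ d * 11) m            ≡⟨ cong (λ j → y ++ v ++ slice j m) second-start ⟨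
    y ++ v ++ slice (p + m + (gap ∸ m)) m     ≡⟨ cong (y ++_) (slice-++ (p + m) (gap ∸ m) m) ⟨
    y ++ slice (p + m) ((gap ∸ m) + m)        ≡⟨ slice-++ p m _ ⟨
    slice p (m + ((gap ∸ m) + m))             ∎
  ∣yv∣≡gap : length (y ++ v) ≡ gap
  ∣yv∣≡gap = trans (length-++ y) (trans (cong₂ _+_ (length-slice p m) (length-slice (p + m) (gap ∸ m))) (m+[n∸m]≡n m≤gap))

2^[1+d]∤2^d*9 : ∀ d → ¬ 2 ^ (d + 1) ∣ 2 ^ d * 9
2^[1+d]∤2^d*9 d dvd with n∣m⇒m%n≡0 9 2 2∣9
  where
  2∣9 : 2 ∣ 9
  2∣9 = *-cancelˡ-∣ (2 ^ d) {{m^n≢0 2 d}} (subst (_∣ 2 ^ d * 9) (^-distribˡ-+-* 2 d 1) dvd)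
... | ()

proposition1 : (m : ℕ) → 2 ≤ m →
    ((y v : List Bool) → length y ≡ m → IsFactor (y ++ v ++ y) →
       2 ^ δ m ∣ length (y ++ v))
    × (∃[ y ] ∃[ v ] (length y ≡ m × IsFactor (y ++ v ++ y)
         × ¬ (2 ^ (δ m + 1) ∣ length (y ++ v))))
proposition1 m _ = divisible , non-divisible (tm-repetition (δ m) (m≤2^δ[m]*3 m))
  where
  divisible : (y v : List Bool) → length y ≡ m → IsFactor (y ++ v ++ y) → 2 ^ δ m ∣ length (y ++ v)
  divisible y v ∣y∣≡m factor = Agree⇒2^δ∣shift m (proj₂ (IsFactor-repetition⇒Agree y v ∣y∣≡m factor))
  non-divisible : ∃[ y ] ∃[ v ] (length y ≡ m × IsFactor (y ++ v ++ y) × length (y ++ v) ≡ 2 ^ δ m * 9) →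
                  ∃[ y ] ∃[ v ] (length y ≡ m × IsFactor (y ++ v ++ y) × ¬ (2 ^ (δ m + 1) ∣ length (y ++ v)))
  non-divisible (y , v , ∣y∣≡m , factor , ∣yv∣≡) =
    y , v , ∣y∣≡m , factor , 2^[1+d]∤2^d*9 (δ m) ∘ subst (2 ^ (δ m + 1) ∣_) ∣yv∣≡
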